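{- For any $i$ with $1\leq i\leq m$, if $(x,y)\in\mathbb{X}_i^*$, then $(x,y)\in\mathbb{X}_{j}^*$ for every $1\leq j\leq i$; equivalently, $x=\pi_i(x)$ implies $x=\pi_j(x)$ for all $1\leq j\leq i$.
   Context: Fix $m\geq 3$. Let $\gamma_0^*:=4m$ and $\gamma_i^*:=4(m-i)\gamma_{i-1}^*$ for $0<i<m$. For $0\leq j\leq i\leq m-1$ let $\beta_{j}^{i}:=\gamma_i^*/\gamma_j^*$. For $x\in\{0,\ldots,\gamma_{m-1}^*-1\}$ and $1\leq i\leq m$ let $[x]_i:=\lfloor x/\beta_{m-i}^{m-1}\rfloor$ and $\pi_i(x):=[x]_i\,\beta_{m-i}^{m-1}+\frac{1}{2}\sum_{1<\ell\leq i}\beta_{m-\ell}^{m-1}$ (written in the paper with a special double-parenthesis notation). Let $\mathbb{X}_1^*:=\{0,\ldots,\gamma_{m-1}^*-1\}\times\{0,1,2\}$ and, for $1<i\leq m$, $\mathbb{X}_i^*:=\{(x,y)\in\mathbb{X}_1^*\mid x=\pi_i(x)\}$. -}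

module Defs where

open import Data.Nat using (ℕ; zero; suc; _+_; _*_; _∸_; _<_; _≤_)
open import Data.Nat.DivMod using (_/_)
open import Data.List using (List; map; upTo)
open import Data.Nat.ListAction using (sum)
open import Data.Product using (_×_)
open import Relation.Binary.PropositionalEquality using (_≡_)

gamma : ℕ → ℕ → ℕ
gamma m zero    = 4 * m
gamma m (suc i) = 4 * (m ∸ suc i) * gamma m i

-- floor division (divisor is always nonzero where used)
divℕ : ℕ → ℕ → ℕ
divℕ x zero    = zero
divℕ x (suc d) = x / suc d

-- β^i_j = γ*_i / γ*_j  (j ≤ i < m; exact quotient, γ*_j ≠ 0)
beta : ℕ → ℕ → ℕ → ℕ
beta m j i = divℕ (gamma m i) (gamma m j)

brk : ℕ → ℕ → ℕ → ℕ
brk m i x = divℕ x (beta m (m ∸ i) (m ∸ 1))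

-- Σ_{1 < ℓ ≤ i} β^{m-1}_{m-ℓ}   (ℓ = 2 + k, k < i - 1)
sumB : ℕ → ℕ → ℕ
sumB m i = sum (map (λ k → beta m (m ∸ (2 + k)) (m ∸ 1)) (upTo (i ∸ 1)))

twoPi : ℕ → ℕ → ℕ → ℕ
twoPi m i x = 2 * (brk m i x * beta m (m ∸ i) (m ∸ 1)) + sumB m i

-- x = π_i(x), cleared of the factor 1/2
IsFixed : ℕ → ℕ → ℕ → Set
IsFixed m i x = 2 * x ≡ twoPi m i x

InX1 : ℕ → ℕ → ℕ → Set
InX1 m x y = (x < gamma m (m ∸ 1)) × (y < 3)

InXi : ℕ → ℕ → ℕ → ℕ → Set
InXi m i x y = InX1 m x y × IsFixed m i x

module Submission where

open import Defs
open import Data.Nat using (ℕ; zero; suc; _+_; _*_; _∸_; _<_; _≤_; _≤′_; ≤′-refl; ≤′-step; z≤n; s≤s; NonZero; >-nonZero)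
open import Data.Nat.Properties
open import Data.Nat.DivMod using (_/_; _%_; m≡m%n+[m/n]*n; m*n/n≡m; [m+kn]%n≡m%n; m<n⇒m%n≡m; m∣n⇒o%n%m≡o%m)
open import Data.Nat.Divisibility using (_∣_; divides; ∣-refl; ∣-trans; m∣m*n)
open import Data.Nat.ListAction using (sum)
open import Data.Nat.ListAction.Properties using (sum-++)
open import Data.Nat.Solver using (module +-*-Solver)
open import Data.List using ([_]; _++_; map; upTo)
open import Data.List.Properties using (upTo-∷ʳ; map-++)
open import Data.Product using (_,_)
open import Function.Bundles using (_⇔_; mk⇔; Equivalence)
open import Relation.Binary.PropositionalEquality using (_≡_; refl; sym; trans; cong; cong₂; module ≡-Reasoning)

-- x = π_{a+1}(x) says exactly that x is congruent to a fixed offset modulo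
-- β^{m-1}_{m-1-a} = 4^a·a!.  For c ≤ a these moduli divide one another, and
-- the offset for a exceeds the offset for c by a multiple of the smaller
-- modulus (each further summand is a multiple of it), so the congruence for a
-- implies the congruence for c.

[m+n]%d≡m%d : ∀ m {n} d .{{_ : NonZero d}} → d ∣ n → (m + n) % d ≡ m % d
[m+n]%d≡m%d m d (divides k refl) = [m+kn]%n≡m%n m k d

x%n≡r⇔x≡x/n*n+r : ∀ {x r} n .{{_ : NonZero n}} → r < n → x % n ≡ r ⇔ x ≡ x / n * n + r
x%n≡r⇔x≡x/n*n+r {x} {r} n r<n = mk⇔ to from
  where
  to : x % n ≡ r → x ≡ x / n * n + r
  to x%n≡r = trans (m≡m%n+[m/n]*n x n) (trans (cong (_+ x / n * n) x%n≡r) (+-comm r _))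

  from : x ≡ x / n * n + r → x % n ≡ r
  from x≡ = begin
    x % n                  ≡⟨ cong (_% n) (trans x≡ (+-comm _ r)) ⟩
    (r + x / n * n) % n    ≡⟨ [m+kn]%n≡m%n r (x / n) n ⟩
    r % n                  ≡⟨ m<n⇒m%n≡m r<n ⟩
    r                      ∎
    where open ≡-Reasoning

divℕ≡/ : ∀ x d .{{_ : NonZero d}} → divℕ x d ≡ x / d
divℕ≡/ x (suc d) = refl

sum-map-upTo-suc : ∀ (f : ℕ → ℕ) n → sum (map f (upTo (suc n))) ≡ sum (map f (upTo n)) + f n
sum-map-upTo-suc f n = begin
  sum (map f (upTo (suc n)))                 ≡⟨ cong (λ l → sum (map f l)) (sym (upTo-∷ʳ n)) ⟩
  sum (map f (upTo n ++ [ n ]))              ≡⟨ cong sum (map-++ f (upTo n) [ n ]) ⟩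
  sum (map f (upTo n) ++ [ f n ])            ≡⟨ sum-++ (map f (upTo n)) [ f n ] ⟩
  sum (map f (upTo n)) + (f n + 0)           ≡⟨ cong (sum (map f (upTo n)) +_) (+-identityʳ (f n)) ⟩
  sum (map f (upTo n)) + f n                 ∎
  where open ≡-Reasoning

m∸n≡suc[m∸suc[n]] : ∀ {m n} → n < m → m ∸ n ≡ suc (m ∸ suc n)
m∸n≡suc[m∸suc[n]] {suc m} {zero}  _         = refl
m∸n≡suc[m∸suc[n]] {suc m} {suc n} (s≤s n<m) = m∸n≡suc[m∸suc[n]] n<m

-- block a is the paper's β^{m-1}_{m-1-a}, and offset a is half of the sum
-- Σ_{1<ℓ≤a+1} β^{m-1}_{m-ℓ} occurring in π_{a+1}.
block : ℕ → ℕ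
block zero    = 1
block (suc a) = block a * (4 * suc a)

offset : ℕ → ℕ
offset zero    = 0
offset (suc a) = offset a + block a * (2 * suc a)

block-nonZero : ∀ a → NonZero (block a)
block-nonZero zero    = _
block-nonZero (suc a) = m*n≢0 (block a) (4 * suc a) {{block-nonZero a}}

-- block is not injective, so instance search cannot use block-nonZero; the
-- residue modulo block a is therefore packaged with its instance once here.
_mod-block_ : ℕ → ℕ → ℕ
x mod-block a = _%_ x (block a) {{block-nonZero a}}

block-∣ : ∀ {c a} → c ≤′ a → block c ∣ block a
block-∣ ≤′-refl        = ∣-refl
block-∣ (≤′-step c≤′a) = ∣-trans (block-∣ c≤′a) (m∣m*n _)

offset<block : ∀ a → offset a < block a
offset<block zero    = s≤s z≤n
offset<block (suc a) = begin-strict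
  offset a + block a * (2 * suc a)  <⟨ +-monoˡ-< _ (offset<block a) ⟩
  block a + block a * (2 * suc a)   ≡⟨ sym (*-suc (block a) _) ⟩
  block a * suc (2 * suc a)         ≤⟨ *-monoʳ-≤ (block a) 1+2n≤4n ⟩
  block a * (4 * suc a)             ∎
  where
  open ≤-Reasoning
  1+2n≤4n : suc (2 * suc a) ≤ 4 * suc a
  1+2n≤4n = ≤-trans (+-monoˡ-≤ (2 * suc a) (s≤s z≤n))
                    (≤-reflexive (sym (*-distribʳ-+ (suc a) 2 2)))

offset-mod-block : ∀ {c a} → c ≤′ a → offset a mod-block c ≡ offset c
offset-mod-block {c} ≤′-refl = m<n⇒m%n≡m {{block-nonZero c}} (offset<block c)
offset-mod-block {c} (≤′-step {a} c≤′a) = begin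
  (offset a + block a * (2 * suc a)) % block c  ≡⟨ [m+n]%d≡m%d (offset a) (block c) (∣-trans (block-∣ c≤′a) (m∣m*n _)) ⟩
  offset a % block c                            ≡⟨ offset-mod-block c≤′a ⟩
  offset c                                      ∎
  where
  open ≡-Reasoning
  instance _ = block-nonZero c

gamma-nonZero : ∀ m k → k < m → NonZero (gamma m k)
gamma-nonZero (suc m) zero    _   = _
gamma-nonZero m       (suc k) k<m =
  m*n≢0 (4 * (m ∸ suc k)) (gamma m k)
    {{m*n≢0 4 (m ∸ suc k) {{_}} {{>-nonZero (m<n⇒0<n∸m k<m)}}}}
    {{gamma-nonZero m k (<-trans (n<1+n k) k<m)}}

gamma-step : ∀ m a → suc a < m → gamma m (m ∸ suc a) ≡ 4 * suc a * gamma m (m ∸ suc (suc a))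
gamma-step m a a+1<m = begin
  gamma m (m ∸ suc a)                                         ≡⟨ cong (gamma m) m∸[a+1]≡ ⟩
  4 * (m ∸ suc (m ∸ suc (suc a))) * gamma m (m ∸ suc (suc a)) ≡⟨ cong (λ k → 4 * (m ∸ k) * gamma m (m ∸ suc (suc a))) (sym m∸[a+1]≡) ⟩
  4 * (m ∸ (m ∸ suc a)) * gamma m (m ∸ suc (suc a))           ≡⟨ cong (λ k → 4 * k * gamma m (m ∸ suc (suc a))) (m∸[m∸n]≡n (<⇒≤ a+1<m)) ⟩
  4 * suc a * gamma m (m ∸ suc (suc a))                       ∎
  where
  open ≡-Reasoning
  m∸[a+1]≡ : m ∸ suc a ≡ suc (m ∸ suc (suc a))
  m∸[a+1]≡ = m∸n≡suc[m∸suc[n]] a+1<m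

gamma-top≡block*gamma : ∀ m a → suc a ≤ m → gamma m (m ∸ 1) ≡ block a * gamma m (m ∸ suc a)
gamma-top≡block*gamma m zero    _       = sym (*-identityˡ _)
gamma-top≡block*gamma m (suc a) a+2≤m = begin
  gamma m (m ∸ 1)                                       ≡⟨ gamma-top≡block*gamma m a (<⇒≤ a+2≤m) ⟩
  block a * gamma m (m ∸ suc a)                         ≡⟨ cong (block a *_) (gamma-step m a a+2≤m) ⟩
  block a * (4 * suc a * gamma m (m ∸ suc (suc a)))     ≡⟨ sym (*-assoc (block a) _ _) ⟩
  block (suc a) * gamma m (m ∸ suc (suc a))             ∎
  where open ≡-Reasoning

beta≡block : ∀ m a → suc a ≤ m → beta m (m ∸ suc a) (m ∸ 1) ≡ block a
beta≡block m a a+1≤m = begin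
  divℕ (gamma m (m ∸ 1)) g            ≡⟨ divℕ≡/ _ g ⟩
  gamma m (m ∸ 1) / g                 ≡⟨ cong (_/ g) (gamma-top≡block*gamma m a a+1≤m) ⟩
  block a * g / g                     ≡⟨ m*n/n≡m (block a) g ⟩
  block a                             ∎
  where
  open ≡-Reasoning
  g = gamma m (m ∸ suc a)
  instance
    g-nonZero : NonZero g
    g-nonZero = gamma-nonZero m (m ∸ suc a) (∸-monoʳ-< (s≤s z≤n) a+1≤m)

sumB≡2*offset : ∀ m a → suc a ≤ m → sumB m (suc a) ≡ 2 * offset a
sumB≡2*offset m zero    _     = refl
sumB≡2*offset m (suc a) a+2≤m = begin
  sumB m (suc (suc a))                                       ≡⟨ sum-map-upTo-suc (λ k → beta m (m ∸ (2 + k)) (m ∸ 1)) a ⟩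
  sumB m (suc a) + beta m (m ∸ suc (suc a)) (m ∸ 1)          ≡⟨ cong₂ _+_ (sumB≡2*offset m a (<⇒≤ a+2≤m)) (beta≡block m (suc a) a+2≤m) ⟩
  2 * offset a + block a * (4 * suc a)                       ≡⟨ halve (offset a) (block a) a ⟩
  2 * offset (suc a)                                         ∎
  where
  open ≡-Reasoning
  open +-*-Solver
  halve : ∀ r b a → 2 * r + b * (4 * suc a) ≡ 2 * (r + b * (2 * suc a))
  halve = solve 3 (λ r b a → con 2 :* r :+ b :* (con 4 :* (con 1 :+ a))
                          := con 2 :* (r :+ b :* (con 2 :* (con 1 :+ a)))) refl

twoPi≡2*[x/block*block+offset] : ∀ m a x → suc a ≤ m →
  twoPi m (suc a) x ≡ 2 * (_/_ x (block a) {{block-nonZero a}} * block a + offset a)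
twoPi≡2*[x/block*block+offset] m a x a+1≤m = begin
  2 * (divℕ x β * β) + sumB m (suc a)               ≡⟨ cong₂ (λ d s → 2 * (divℕ x d * d) + s) (beta≡block m a a+1≤m) (sumB≡2*offset m a a+1≤m) ⟩
  2 * (divℕ x (block a) * block a) + 2 * offset a   ≡⟨ cong (λ q → 2 * (q * block a) + 2 * offset a) (divℕ≡/ x (block a)) ⟩
  2 * (x / block a * block a) + 2 * offset a        ≡⟨ sym (*-distribˡ-+ 2 (x / block a * block a) (offset a)) ⟩
  2 * (x / block a * block a + offset a)            ∎
  where
  open ≡-Reasoning
  instance _ = block-nonZero a
  β = beta m (m ∸ suc a) (m ∸ 1)

isFixed⇔x-mod-block≡offset : ∀ m a x → suc a ≤ m → IsFixed m (suc a) x ⇔ x mod-block a ≡ offset a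
isFixed⇔x-mod-block≡offset m a x a+1≤m = mk⇔
  (λ fixed → from residue (*-cancelˡ-≡ x _ 2 (trans fixed twoPi≡)))
  (λ x-mod-block≡offset → trans (cong (2 *_) (to residue x-mod-block≡offset)) (sym twoPi≡))
  where
  open Equivalence
  instance _ = block-nonZero a
  residue = x%n≡r⇔x≡x/n*n+r (block a) (offset<block a)
  twoPi≡ = twoPi≡2*[x/block*block+offset] m a x a+1≤m

lemma5p2 : (m : ℕ) → 3 ≤ m →
    (i : ℕ) → 1 ≤ i → i ≤ m →
    (x y : ℕ) → InXi m i x y →
    (j : ℕ) → 1 ≤ j → j ≤ i → InXi m j x y
lemma5p2 m _ (suc a) _ a+1≤m x y (inX1 , fixed) (suc c) _ (s≤s c≤a) =
  inX1 , from (isFixed⇔x-mod-block≡offset m c x (≤-trans (s≤s c≤a) a+1≤m)) x-mod-block-c≡offset-c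
  where
  open Equivalence
  open ≡-Reasoning
  instance
    _ = block-nonZero a
    _ = block-nonZero c
  x-mod-block-c≡offset-c : x mod-block c ≡ offset c
  x-mod-block-c≡offset-c = begin
    x % block c              ≡⟨ sym (m∣n⇒o%n%m≡o%m (block c) (block a) x (block-∣ (≤⇒≤′ c≤a))) ⟩
    x % block a % block c    ≡⟨ cong (_% block c) (to (isFixed⇔x-mod-block≡offset m a x a+1≤m) fixed) ⟩
    offset a % block c       ≡⟨ offset-mod-block (≤⇒≤′ c≤a) ⟩
    offset c                 ∎
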